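{- Let $p$ be a prime, $q=p^a$, $A=\{\mathbf a_1,\dots,\mathbf a_N\}\subseteq\mathbb Z^n$, and let $M\subseteq\mathbb Z^n$ satisfy: for every $\mathbf a\in M$ and every expression $\mathbf a=\sum_{i=1}^Nc_i\mathbf a_i$ with $c_i\in\mathbb N$, if $c_{i_0}\ge q$ for some $i_0$ then $\mathbf a-(q-1)\mathbf a_{i_0}\in M$. Assume $U_M\ne\emptyset$. Let $\Gamma_M$ be the set of all sequences $(\gamma_0,\dots,\gamma_{a-1})$ of good elements of $\mathbb NA$ such that $\sum_{k=0}^{a-1}p^k\gamma_k\in M$ and $w_p(M)=\sum_{k=0}^{a-1}w(\gamma_k)$. For $(\gamma_0,\dots,\gamma_{a-1})\in\Gamma_M$ let $U(\gamma_0,\dots,\gamma_{a-1})$ be the set of all $u\in\mathbb N^N$ of the form $u_i=\sum_{k=0}^{a-1}u^{(k)}_ip^k$ ($i=1,\dots,N$) with $u^{(k)}\in U^+_{\min}(\gamma_k)$ for $k=0,\dots,a-1$. Then the sets $U(\gamma_0,\dots,\gamma_{a-1})$, $(\gamma_0,\dots,\gamma_{a-1})\in\Gamma_M$, are pairwise disjoint and $$U_{M,\min}=\bigcup_{(\gamma_0,\dots,\gamma_{a-1})\in\Gamma_M}U(\gamma_0,\dots,\gamma_{a-1}).$$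
   Context: $\mathbb N=\{0,1,\dots\}$, $\mathbb NA=\{\sum_ic_i\mathbf a_i:c_i\in\mathbb N\}$. For $\gamma\in\mathbb NA$: $U^+(\gamma)=\{u\in\mathbb N^N:\sum_iu_i\mathbf a_i=\gamma\}$, $w(\gamma)=\min\{\sum_iu_i:u\in U^+(\gamma)\}$, $U^+_{\min}(\gamma)=\{u\in U^+(\gamma):\sum_iu_i=w(\gamma)\}$; $\gamma$ is good if every $u\in U^+_{\min}(\gamma)$ has all $u_i\le p-1$. Let $U^+_{q-1}=\{u\in\mathbb Z^N:0\le u_i\le q-1\ \forall i\}$. For $u\in U^+_{q-1}$ with base-$p$ digits $u_i=\sum_{k=0}^{a-1}u^{(k)}_ip^k$ ($0\le u^{(k)}_i\le p-1$), $w_p(u)=\sum_{i}\sum_{k}u^{(k)}_i$. $U_M=\{u\in U^+_{q-1}:\sum_iu_i\mathbf a_i\in M\}$, $w_p(M)=\min\{w_p(u):u\in U_M\}$, $U_{M,\min}=\{u\in U_M:w_p(u)=w_p(M)\}$. -}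

module Defs where

open import Data.Nat as ℕ using (ℕ; zero; suc; _≤_; _<_; _∸_; _^_; _/_; _%_)
open import Data.Integer as ℤ using (ℤ; +_)
import Data.Fin
import Data.Nat.Properties
open import Data.Fin using (Fin; zero; suc)
open import Data.Vec using (Vec; lookup; tabulate; zipWith; map; replicate)
open import Data.Product using (Σ; ∃; _×_; _,_)
open import Relation.Binary.PropositionalEquality using (_≡_)

Σℕ : ∀ {m} → (Fin m → ℕ) → ℕ
Σℕ {zero}  f = 0
Σℕ {suc m} f = f zero ℕ.+ Σℕ (λ i → f (suc i))

Σᵥ : ∀ {n m} → (Fin m → Vec ℤ n) → Vec ℤ n
Σᵥ {n} {zero}  f = replicate n (+ 0)
Σᵥ {n} {suc m} f = zipWith ℤ._+_ (f zero) (Σᵥ (λ i → f (suc i)))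

_·_ : ∀ {n} → ℕ → Vec ℤ n → Vec ℤ n
c · v = map (λ x → + c ℤ.* x) v

_-ᵥ_ : ∀ {n} → Vec ℤ n → Vec ℤ n → Vec ℤ n
_-ᵥ_ = zipWith ℤ._-_

module Setup {n N : ℕ} (A : Fin N → Vec ℤ n) where

  comb : Vec ℕ N → Vec ℤ n
  comb u = Σᵥ (λ i → lookup u i · A i)

  size : Vec ℕ N → ℕ
  size u = Σℕ (λ i → lookup u i)

  InNA : Vec ℤ n → Set
  InNA γ = ∃ λ (c : Vec ℕ N) → comb c ≡ γ

  U⁺ : Vec ℤ n → Vec ℕ N → Set
  U⁺ γ u = comb u ≡ γ

  U⁺min : Vec ℤ n → Vec ℕ N → Set
  U⁺min γ u = U⁺ γ u × (∀ v → U⁺ γ v → size u ≤ size v)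

  IsW : Vec ℤ n → ℕ → Set
  IsW γ m = (∃ λ u → U⁺ γ u × size u ≡ m) × (∀ v → U⁺ γ v → m ≤ size v)

  Good : ℕ → Vec ℤ n → Set
  Good p γ = InNA γ × (∀ u → U⁺min γ u → ∀ i → lookup u i ≤ p ∸ 1)

  module WithPrime (p : ℕ) {{p≢0 : ℕ.NonZero p}} (a : ℕ) (M : Vec ℤ n → Set) where

    q : ℕ
    q = p ^ a

    digit : ℕ → ℕ → ℕ
    digit x k = ((x / p ^ k) {{Data.Nat.Properties.m^n≢0 p k}}) % p

    Uq : Vec ℕ N → Set
    Uq u = ∀ i → lookup u i ≤ q ∸ 1

    wp : Vec ℕ N → ℕ
    wp u = Σℕ (λ i → Σℕ {a} (λ k → digit (lookup u i) (Data.Fin.toℕ k)))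

    UM : Vec ℕ N → Set
    UM u = Uq u × M (comb u)

    UMmin : Vec ℕ N → Set
    UMmin u = UM u × (∀ v → UM v → wp u ≤ wp v)

    IsWpM : ℕ → Set
    IsWpM m = (∃ λ u → UM u × wp u ≡ m) × (∀ v → UM v → m ≤ wp v)

    expand : Vec (Vec ℤ n) a → Vec ℤ n
    expand γ = Σᵥ (λ k → (p ^ Data.Fin.toℕ k) · lookup γ k)

    ΓM : Vec (Vec ℤ n) a → Set
    ΓM γ = (∀ k → Good p (lookup γ k))
         × M (expand γ)
         × (∃ λ (ws : Fin a → ℕ) → (∀ k → IsW (lookup γ k) (ws k)) × IsWpM (Σℕ ws))

    Uγ : Vec (Vec ℤ n) a → Vec ℕ N → Set
    Uγ γ u = ∃ λ (us : Fin a → Vec ℕ N)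
           → (∀ k → U⁺min (lookup γ k) (us k))
           × (∀ i → lookup u i ≡ Σℕ (λ k → lookup (us k) i ℕ.* p ^ Data.Fin.toℕ k))

{-# OPTIONS --safe #-}
-- Write u ∈ U⁺_{q-1} through its base-p digit vectors u⁽⁰⁾, …, u⁽ᵃ⁻¹⁾, so that w_p(u) = Σ_k |u⁽ᵏ⁾| and
-- Σ_i u_i a_i = Σ_k p^k γ_k with γ_k = Σ_i u⁽ᵏ⁾_i a_i.  Give every c ∈ ℕ^N the weight
-- Σ_i (sum of the first a base-p digits of c_i + ⌊c_i / q⌋).  Propagating carries never increases this
-- weight, and strictly decreases it when some "digit" is ≥ p; replacing a coordinate c_i ≥ q by
-- c_i - (q - 1) does not increase it either.  The hypothesis on M allows exactly these replacements, so
-- every c with Σ_i c_i a_i ∈ M yields some u ∈ U_M with w_p(u) ≤ weight(c).  Now let u ∈ U_{M,min} and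
-- replace one digit vector u⁽ᵏ⁾ by any v with the same γ_k: the recombined vector has weight at most
-- w_p(u) - |u⁽ᵏ⁾| + |v|, whence u⁽ᵏ⁾ ∈ U⁺_min(γ_k), and the bound is strict if some v_i ≥ p, whence γ_k is
-- good.  Conversely, vectors of digits < p are base-p expansions, which are unique; this gives the
-- reverse inclusion and the disjointness.
module Submission where

open import Defs
open import Data.Nat using (ℕ; zero; suc; _≤_; _<_; _^_; _∸_; NonZero; nonTrivial⇒n>1)
open import Data.Nat.Primality using (Prime; prime⇒nonZero; prime⇒nonTrivial)
open import Data.Integer using (ℤ)
open import Data.Fin using (Fin; zero; suc; toℕ; punchIn)
open import Data.Fin.Properties using (punchInᵢ≢i)
open import Data.Vec using (Vec; lookup)
open import Data.Product using (∃; _×_; _,_; proj₁; proj₂)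
open import Function using (_∘_; id)
open import Function.Bundles using (_⇔_; mk⇔)
open import Relation.Binary.PropositionalEquality
  using (_≡_; _≢_; refl; sym; trans; cong; cong₂; subst; module ≡-Reasoning)
open import Algebra.Bundles using (CommutativeMonoid)
import Algebra.Properties.CommutativeMonoid.Sum as MonoidSum
import Algebra.Properties.CommutativeSemigroup as CommutativeSemigroupProperties
import Algebra.Properties.Semiring.Sum as SemiringSum
import Data.Vec.Functional as Vector
open import Data.Vec.Relation.Binary.Pointwise.Extensional using (ext; Pointwise-≡⇒≡)

module _ {c ℓ} (M : CommutativeMonoid c ℓ) where
  open CommutativeMonoid M
  open MonoidSum M using (sum; sum-remove; sum-cong-≗)
  open CommutativeSemigroupProperties commutativeSemigroup using (xy∙z≈zy∙x)
  open import Relation.Binary.Reasoning.Setoid setoid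

  sum-exchange : ∀ {m} {f g : Fin m → Carrier} i →
                 (∀ j → j ≢ i → f j ≡ g j) → sum f ∙ g i ≈ sum g ∙ f i
  sum-exchange {suc m} {f} {g} i agree = begin
    sum f ∙ g i                                   ≈⟨ ∙-congʳ (sum-remove f) ⟩
    (f i ∙ sum (Vector.removeAt f i)) ∙ g i       ≡⟨ cong (λ r → (f i ∙ r) ∙ g i) rest ⟩
    (f i ∙ sum (Vector.removeAt g i)) ∙ g i       ≈⟨ xy∙z≈zy∙x (f i) _ (g i) ⟩
    (g i ∙ sum (Vector.removeAt g i)) ∙ f i       ≈⟨ ∙-congʳ (sum-remove g) ⟨
    sum g ∙ f i                                   ∎
    where
    rest : sum (Vector.removeAt f i) ≡ sum (Vector.removeAt g i)
    rest = sum-cong-≗ (λ j → agree (punchIn i j) (punchInᵢ≢i i j))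

module NaturalSum where
  open import Data.Nat using (zero; suc; _+_; _*_)
  open import Data.Nat.Properties
  open import Data.Vec using (updateAt)
  open import Data.Vec.Properties using (lookup∘updateAt; lookup∘updateAt′)
  open MonoidSum +-0-commutativeMonoid using (sum)
  open CommutativeSemigroupProperties +-commutativeSemigroup using (interchange)

  Σℕ-cong : ∀ {m} {f g : Fin m → ℕ} → (∀ i → f i ≡ g i) → Σℕ f ≡ Σℕ g
  Σℕ-cong {zero}  f≗g = refl
  Σℕ-cong {suc m} f≗g = cong₂ _+_ (f≗g zero) (Σℕ-cong (f≗g ∘ suc))

  Σℕ-mono-≤ : ∀ {m} {f g : Fin m → ℕ} → (∀ i → f i ≤ g i) → Σℕ f ≤ Σℕ g
  Σℕ-mono-≤ {zero}  f≤g = ≤-refl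
  Σℕ-mono-≤ {suc m} f≤g = +-mono-≤ (f≤g zero) (Σℕ-mono-≤ (f≤g ∘ suc))

  Σℕ-mono-< : ∀ {m} {f g : Fin m → ℕ} → (∀ i → f i ≤ g i) → ∀ j → f j < g j → Σℕ f < Σℕ g
  Σℕ-mono-< {suc m} f≤g zero    f₀<g₀ = +-mono-<-≤ f₀<g₀ (Σℕ-mono-≤ (f≤g ∘ suc))
  Σℕ-mono-< {suc m} f≤g (suc j) fⱼ<gⱼ = +-mono-≤-< (f≤g zero) (Σℕ-mono-< (f≤g ∘ suc) j fⱼ<gⱼ)

  Σℕ-*ʳ : ∀ {m} (f : Fin m → ℕ) c → Σℕ (λ i → f i * c) ≡ Σℕ f * c
  Σℕ-*ʳ {zero}  f c = refl
  Σℕ-*ʳ {suc m} f c = trans (cong (f zero * c +_) (Σℕ-*ʳ (f ∘ suc) c)) (sym (*-distribʳ-+ c (f zero) _))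

  Σℕ-zero : ∀ m → Σℕ {m} (λ _ → 0) ≡ 0
  Σℕ-zero zero    = refl
  Σℕ-zero (suc m) = Σℕ-zero m

  Σℕ-+ : ∀ {m} (f g : Fin m → ℕ) → Σℕ (λ i → f i + g i) ≡ Σℕ f + Σℕ g
  Σℕ-+ {zero}  f g = refl
  Σℕ-+ {suc m} f g =
    trans (cong (f zero + g zero +_) (Σℕ-+ (f ∘ suc) (g ∘ suc))) (interchange (f zero) (g zero) _ _)

  Σℕ-comm : ∀ {m k} (f : Fin m → Fin k → ℕ) → Σℕ (λ i → Σℕ (f i)) ≡ Σℕ (λ j → Σℕ (λ i → f i j))
  Σℕ-comm {zero}  {k} f = sym (Σℕ-zero k)
  Σℕ-comm {suc m}     f = trans (cong (Σℕ (f zero) +_) (Σℕ-comm (f ∘ suc))) (sym (Σℕ-+ (f zero) _))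

  Σℕ≡sum : ∀ {m} (f : Fin m → ℕ) → Σℕ f ≡ sum f
  Σℕ≡sum {zero}  f = refl
  Σℕ≡sum {suc m} f = cong (f zero +_) (Σℕ≡sum (f ∘ suc))

  Σℕ-exchange : ∀ {m} {f g : Fin m → ℕ} i → (∀ j → j ≢ i → f j ≡ g j) → Σℕ f + g i ≡ Σℕ g + f i
  Σℕ-exchange {f = f} {g} i agree = begin
    Σℕ f + g i  ≡⟨ cong (_+ g i) (Σℕ≡sum f) ⟩
    sum f + g i ≡⟨ sum-exchange +-0-commutativeMonoid i agree ⟩
    sum g + f i ≡⟨ cong (_+ f i) (Σℕ≡sum g) ⟨
    Σℕ g + f i  ∎
    where open ≡-Reasoning

  module _ {m} (h : ℕ → ℕ) (c : Vec ℕ m) (i : Fin m) (f : ℕ → ℕ) where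
    private
      Σ-updated = Σℕ (λ j → h (lookup (updateAt c i f) j))
      Σ-original = Σℕ (λ j → h (lookup c j))

      Σ-updateAt : Σ-updated + h (lookup c i) ≡ Σ-original + h (f (lookup c i))
      Σ-updateAt = trans (Σℕ-exchange i agree) (cong (λ x → Σ-original + h x) (lookup∘updateAt i c))
        where
        agree : ∀ j → j ≢ i → h (lookup (updateAt c i f) j) ≡ h (lookup c j)
        agree j j≢i = cong h (lookup∘updateAt′ j i j≢i c)

    Σℕ-updateAt-≤ : h (f (lookup c i)) ≤ h (lookup c i) → Σ-updated ≤ Σ-original
    Σℕ-updateAt-≤ hf≤h = +-cancelʳ-≤ (h (lookup c i)) _ _
      (≤-trans (≤-reflexive Σ-updateAt) (+-monoʳ-≤ Σ-original hf≤h))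

    Σℕ-updateAt-< : h (f (lookup c i)) < h (lookup c i) → Σ-updated < Σ-original
    Σℕ-updateAt-< hf<h = +-cancelʳ-< (h (lookup c i)) _ _
      (≤-<-trans (≤-reflexive Σ-updateAt) (+-monoʳ-< Σ-original hf<h))

open NaturalSum

module Digits (p : ℕ) {{_ : NonZero p}} (1<p : 1 < p) where
  open import Data.Nat using (zero; suc; _+_; _*_; _/_; _%_; >-nonZero; >-nonZero⁻¹)
  open import Data.Nat.Properties
  open import Data.Nat.DivMod
  open import Data.Nat.Divisibility using (divides)
  open import Data.Nat.Tactic.RingSolver using (solve-∀)

  fromDigits : ∀ a → (Fin a → ℕ) → ℕ → ℕ
  fromDigits zero    d t = t
  fromDigits (suc a) d t = d zero + fromDigits a (d ∘ suc) t * p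

  digits : ∀ a → ℕ → Fin a → ℕ
  digits (suc a) x zero    = x % p
  digits (suc a) x (suc k) = digits a (x / p) k

  high : ℕ → ℕ → ℕ
  high zero    x = x
  high (suc a) x = high a (x / p)

  -- The base-p digit sum of x in which everything above the first a digits counts as the single
  -- digit ⌊x / p^a⌋; on x < p^a it is the digit sum entering w_p.
  weight : ℕ → ℕ → ℕ
  weight a x = Σℕ (digits a x) + high a x

  weight-suc : ∀ a x → weight (suc a) x ≡ x % p + weight a (x / p)
  weight-suc a x = +-assoc (x % p) _ _

  [m+y*p]%p≡m%p : ∀ m y → (m + y * p) % p ≡ m % p
  [m+y*p]%p≡m%p m y = [m+kn]%n≡m%n m y p

  [m+y*p]/p≡m/p+y : ∀ m y → (m + y * p) / p ≡ m / p + y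
  [m+y*p]/p≡m/p+y m y = trans (+-distrib-/-∣ʳ m (divides y refl)) (cong (m / p +_) (m*n/n≡m y p))

  fromDigits-digits : ∀ a x → fromDigits a (digits a x) (high a x) ≡ x
  fromDigits-digits zero    x = refl
  fromDigits-digits (suc a) x =
    trans (cong (λ y → x % p + y * p) (fromDigits-digits a (x / p))) (sym (m≡m%n+[m/n]*n x p))

  digits-fromDigits : ∀ a (d : Fin a → ℕ) t → (∀ k → d k < p) →
                      (∀ k → digits a (fromDigits a d t) k ≡ d k) × high a (fromDigits a d t) ≡ t
  digits-fromDigits zero    d t d<p = (λ ()) , refl
  digits-fromDigits (suc a) d t d<p = digits≡ , trans (cong (high a) shift) (proj₂ ih)
    where
    y = fromDigits a (d ∘ suc) t
    ih = digits-fromDigits a (d ∘ suc) t (d<p ∘ suc)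
    shift : (d zero + y * p) / p ≡ y
    shift = trans ([m+y*p]/p≡m/p+y (d zero) y) (cong (_+ y) (m<n⇒m/n≡0 (d<p zero)))
    digits≡ : ∀ k → digits (suc a) (fromDigits (suc a) d t) k ≡ d k
    digits≡ zero    = trans ([m+y*p]%p≡m%p (d zero) y) (m<n⇒m%n≡m (d<p zero))
    digits≡ (suc k) = trans (cong (λ z → digits a z k) shift) (proj₁ ih k)

  high≡/ : ∀ a x → high a x ≡ (x / p ^ a) {{m^n≢0 p a}}
  high≡/ zero    x = sym (n/1≡n x)
  high≡/ (suc a) x =
    trans (high≡/ a (x / p)) (m/n/o≡m/[n*o] x p (p ^ a) {{_}} {{m^n≢0 p a}} {{m^n≢0 p (suc a)}})

  digits≡digit : ∀ a x k → digits a x k ≡ ((x / p ^ toℕ k) {{m^n≢0 p (toℕ k)}}) % p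
  digits≡digit (suc a) x zero    = cong (_% p) (sym (n/1≡n x))
  digits≡digit (suc a) x (suc k) = trans (digits≡digit a (x / p) k)
    (cong (_% p) (m/n/o≡m/[n*o] x p (p ^ toℕ k) {{_}} {{m^n≢0 p (toℕ k)}} {{m^n≢0 p (suc (toℕ k))}}))

  high≡0⇒< : ∀ a x → high a x ≡ 0 → x < p ^ a
  high≡0⇒< a x h≡0 = m/n≡0⇒m<n {{m^n≢0 p a}} (trans (sym (high≡/ a x)) h≡0)

  <⇒high≡0 : ∀ a x → x < p ^ a → high a x ≡ 0
  <⇒high≡0 a x x<pᵃ = trans (high≡/ a x) (m<n⇒m/n≡0 {{m^n≢0 p a}} x<pᵃ)

  ≤⇒high>0 : ∀ a x → p ^ a ≤ x → 0 < high a x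
  ≤⇒high>0 a x pᵃ≤x = subst (0 <_) (sym (high≡/ a x)) (m≥n⇒m/n>0 {{m^n≢0 p a}} pᵃ≤x)

  Σ≡fromDigits : ∀ a (d : Fin a → ℕ) → Σℕ (λ k → d k * p ^ toℕ k) ≡ fromDigits a d 0
  Σ≡fromDigits zero    d = refl
  Σ≡fromDigits (suc a) d = cong₂ _+_ (*-identityʳ (d zero)) (begin
      Σℕ (λ k → d (suc k) * (p * p ^ toℕ k)) ≡⟨ Σℕ-cong (λ k → reassoc (d (suc k)) p (p ^ toℕ k)) ⟩
      Σℕ (λ k → d (suc k) * p ^ toℕ k * p)   ≡⟨ Σℕ-*ʳ (λ k → d (suc k) * p ^ toℕ k) p ⟩
      Σℕ (λ k → d (suc k) * p ^ toℕ k) * p   ≡⟨ cong (_* p) (Σ≡fromDigits a (d ∘ suc)) ⟩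
      fromDigits a (d ∘ suc) 0 * p           ∎)
    where
    open ≡-Reasoning
    reassoc : ∀ x y z → x * (y * z) ≡ x * z * y
    reassoc = solve-∀

  fromDigits-suc : ∀ a d t → fromDigits a d (suc t) ≡ fromDigits a d t + p ^ a
  fromDigits-suc zero    d t = +-comm 1 t
  fromDigits-suc (suc a) d t =
    trans (cong (λ y → d zero + y * p) (fromDigits-suc a (d ∘ suc) t)) (distrib (d zero) y (p ^ a) p)
    where
    y = fromDigits a (d ∘ suc) t
    distrib : ∀ x y z w → x + (y + z) * w ≡ x + y * w + w * z
    distrib = solve-∀

  %+/≤ : ∀ m → m % p + m / p ≤ m
  %+/≤ m = begin
    m % p + m / p      ≤⟨ +-monoʳ-≤ (m % p) (m≤m*n (m / p) p) ⟩
    m % p + m / p * p  ≡⟨ m≡m%n+[m/n]*n m p ⟨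
    m                  ∎
    where open ≤-Reasoning

  %+/< : ∀ m → p ≤ m → m % p + m / p < m
  %+/< m p≤m = begin-strict
    m % p + m / p      <⟨ +-monoʳ-< (m % p) (m<m*n (m / p) p 1<p) ⟩
    m % p + m / p * p  ≡⟨ m≡m%n+[m/n]*n m p ⟨
    m                  ∎
    where
    open ≤-Reasoning
    instance
      m/p≢0 : NonZero (m / p)
      m/p≢0 = >-nonZero (m≥n⇒m/n>0 p≤m)

  weight-carry-step : ∀ a (d : Fin (suc a) → ℕ) t e → let m = e + d zero in
    weight (suc a) (e + fromDigits (suc a) d t) ≡ m % p + weight a (m / p + fromDigits a (d ∘ suc) t)
  weight-carry-step a d t e = begin
    weight (suc a) (e + (d zero + y * p))         ≡⟨ cong (weight (suc a)) (+-assoc e (d zero) (y * p)) ⟨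
    weight (suc a) (m + y * p)                    ≡⟨ weight-suc a (m + y * p) ⟩
    (m + y * p) % p + weight a ((m + y * p) / p)
      ≡⟨ cong₂ (λ r s → r + weight a s) ([m+y*p]%p≡m%p m y) ([m+y*p]/p≡m/p+y m y) ⟩
    m % p + weight a (m / p + y)                  ∎
    where
    open ≡-Reasoning
    m = e + d zero
    y = fromDigits a (d ∘ suc) t

  private
    regroup : ∀ x y s t → x + (y + s + t) ≡ x + y + s + t
    regroup = solve-∀

  carry-collapse-≤ : ∀ a (d : Fin (suc a) → ℕ) t e → let m = e + d zero in
                     m % p + (m / p + Σℕ (d ∘ suc) + t) ≤ e + Σℕ d + t
  carry-collapse-≤ a d t e = begin
    m % p + (m / p + S + t)  ≡⟨ regroup (m % p) (m / p) S t ⟩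
    m % p + m / p + S + t    ≤⟨ +-monoˡ-≤ t (+-monoˡ-≤ S (%+/≤ m)) ⟩
    m + S + t                ≡⟨ cong (_+ t) (+-assoc e (d zero) S) ⟩
    e + Σℕ d + t             ∎
    where
    open ≤-Reasoning
    m = e + d zero
    S = Σℕ (d ∘ suc)

  carry-collapse-< : ∀ a (d : Fin (suc a) → ℕ) t e → p ≤ d zero → let m = e + d zero in
                     m % p + (m / p + Σℕ (d ∘ suc) + t) < e + Σℕ d + t
  carry-collapse-< a d t e p≤d₀ = begin-strict
    m % p + (m / p + S + t)  ≡⟨ regroup (m % p) (m / p) S t ⟩
    m % p + m / p + S + t    <⟨ +-monoˡ-< t (+-monoˡ-< S (%+/< m (≤-trans p≤d₀ (m≤n+m (d zero) e)))) ⟩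
    m + S + t                ≡⟨ cong (_+ t) (+-assoc e (d zero) S) ⟩
    e + Σℕ d + t             ∎
    where
    open ≤-Reasoning
    m = e + d zero
    S = Σℕ (d ∘ suc)

  weight-carry-≤ : ∀ a (d : Fin a → ℕ) t e → weight a (e + fromDigits a d t) ≤ e + Σℕ d + t
  weight-carry-≤ zero    d t e = ≤-reflexive (cong (_+ t) (sym (+-identityʳ e)))
  weight-carry-≤ (suc a) d t e = begin
    weight (suc a) (e + fromDigits (suc a) d t)  ≡⟨ weight-carry-step a d t e ⟩
    m % p + weight a (m / p + fromDigits a (d ∘ suc) t)
      ≤⟨ +-monoʳ-≤ (m % p) (weight-carry-≤ a (d ∘ suc) t (m / p)) ⟩
    m % p + (m / p + Σℕ (d ∘ suc) + t)           ≤⟨ carry-collapse-≤ a d t e ⟩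
    e + Σℕ d + t                                 ∎
    where
    open ≤-Reasoning
    m = e + d zero

  weight-carry-< : ∀ a (d : Fin a → ℕ) t e j → p ≤ d j → weight a (e + fromDigits a d t) < e + Σℕ d + t
  weight-carry-< (suc a) d t e zero p≤d₀ = begin-strict
    weight (suc a) (e + fromDigits (suc a) d t)  ≡⟨ weight-carry-step a d t e ⟩
    m % p + weight a (m / p + fromDigits a (d ∘ suc) t)
      ≤⟨ +-monoʳ-≤ (m % p) (weight-carry-≤ a (d ∘ suc) t (m / p)) ⟩
    m % p + (m / p + Σℕ (d ∘ suc) + t)           <⟨ carry-collapse-< a d t e p≤d₀ ⟩
    e + Σℕ d + t                                 ∎
    where
    open ≤-Reasoning
    m = e + d zero
  weight-carry-< (suc a) d t e (suc j) p≤dⱼ = begin-strict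
    weight (suc a) (e + fromDigits (suc a) d t)  ≡⟨ weight-carry-step a d t e ⟩
    m % p + weight a (m / p + fromDigits a (d ∘ suc) t)
      <⟨ +-monoʳ-< (m % p) (weight-carry-< a (d ∘ suc) t (m / p) j p≤dⱼ) ⟩
    m % p + (m / p + Σℕ (d ∘ suc) + t)           ≤⟨ carry-collapse-≤ a d t e ⟩
    e + Σℕ d + t                                 ∎
    where
    open ≤-Reasoning
    m = e + d zero

  weight-∸ : ∀ a c → p ^ a ≤ c → weight a (c ∸ (p ^ a ∸ 1)) ≤ weight a c
  weight-∸ a c pᵃ≤c = begin
    weight a (c ∸ (p ^ a ∸ 1))    ≡⟨ cong (weight a) c∸[pᵃ∸1]≡ ⟩
    weight a (1 + fromDigits a D t)  ≤⟨ weight-carry-≤ a D t 1 ⟩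
    1 + Σℕ D + t                  ≡⟨ +-suc (Σℕ D) t ⟨
    Σℕ D + suc t                  ≡⟨ cong (Σℕ D +_) high≡ ⟨
    weight a c                    ∎
    where
    open ≤-Reasoning
    t = high a c ∸ 1
    high≡ : high a c ≡ suc t
    high≡ = sym (suc-pred (high a c) {{>-nonZero (≤⇒high>0 a c pᵃ≤c)}})
    D = digits a c
    X = fromDigits a D t
    c≡ : c ≡ X + p ^ a
    c≡ = trans (sym (fromDigits-digits a c)) (trans (cong (fromDigits a D) high≡) (fromDigits-suc a D t))
    1≤pᵃ : 1 ≤ p ^ a
    1≤pᵃ = >-nonZero⁻¹ (p ^ a) {{m^n≢0 p a}}
    c∸[pᵃ∸1]≡ : c ∸ (p ^ a ∸ 1) ≡ 1 + X
    c∸[pᵃ∸1]≡ = begin-equality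
      c ∸ (p ^ a ∸ 1)                ≡⟨ cong (_∸ (p ^ a ∸ 1)) c≡ ⟩
      X + p ^ a ∸ (p ^ a ∸ 1)        ≡⟨ +-∸-assoc X (m∸n≤m (p ^ a) 1) ⟩
      X + (p ^ a ∸ (p ^ a ∸ 1))      ≡⟨ cong (X +_) (m∸[m∸n]≡n 1≤pᵃ) ⟩
      X + 1                          ≡⟨ +-comm X 1 ⟩
      1 + X                          ∎

  Σ-digits : ∀ a x → x < p ^ a → Σℕ (λ k → digits a x k * p ^ toℕ k) ≡ x
  Σ-digits a x x<pᵃ = begin
    Σℕ (λ k → digits a x k * p ^ toℕ k)   ≡⟨ Σ≡fromDigits a (digits a x) ⟩
    fromDigits a (digits a x) 0           ≡⟨ cong (fromDigits a (digits a x)) (<⇒high≡0 a x x<pᵃ) ⟨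
    fromDigits a (digits a x) (high a x)  ≡⟨ fromDigits-digits a x ⟩
    x                                     ∎
    where open ≡-Reasoning

  digits-Σ : ∀ a (d : Fin a → ℕ) → (∀ k → d k < p) → let x = Σℕ (λ k → d k * p ^ toℕ k) in
             (∀ k → digits a x k ≡ d k) × x < p ^ a
  digits-Σ a d d<p rewrite Σ≡fromDigits a d =
    proj₁ (digits-fromDigits a d 0 d<p) , high≡0⇒< a _ (proj₂ (digits-fromDigits a d 0 d<p))

  weight-< : ∀ a x → x < p ^ a → weight a x ≡ Σℕ (digits a x)
  weight-< a x x<pᵃ = trans (cong (Σℕ (digits a x) +_) (<⇒high≡0 a x x<pᵃ)) (+-identityʳ _)

  weight-Σ-≤ : ∀ a (d : Fin a → ℕ) → weight a (Σℕ (λ k → d k * p ^ toℕ k)) ≤ Σℕ d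
  weight-Σ-≤ a d rewrite Σ≡fromDigits a d = ≤-trans (weight-carry-≤ a d 0 0) (≤-reflexive (+-identityʳ _))

  weight-Σ-< : ∀ a (d : Fin a → ℕ) j → p ≤ d j → weight a (Σℕ (λ k → d k * p ^ toℕ k)) < Σℕ d
  weight-Σ-< a d j p≤dⱼ rewrite Σ≡fromDigits a d =
    ≤-trans (weight-carry-< a d 0 0 j p≤dⱼ) (≤-reflexive (+-identityʳ _))

module LinearCombination {n N : ℕ} (A : Fin N → Vec ℤ n) where
  import Data.Nat as ℕ using (_*_)
  open import Data.Integer using (+_; _+_; _-_; _*_)
  import Data.Integer.Properties as ℤ
  open import Data.Integer.Tactic.RingSolver using (solve-∀)
  open import Data.Vec using (tabulate; updateAt; zipWith)
  open import Data.Vec.Properties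
    using (lookup∘tabulate; lookup∘updateAt; lookup∘updateAt′; lookup-map; lookup-zipWith; lookup-replicate)
  open Setup A
  open SemiringSum ℤ.+-*-semiring using (sum; sum-cong-≗; ∑-comm; *-distribˡ-sum; *-distribʳ-sum)

  +-Σℕ : ∀ {m} (f : Fin m → ℕ) → + Σℕ f ≡ sum (+_ ∘ f)
  +-Σℕ {zero}  f = refl
  +-Σℕ {suc m} f = trans (ℤ.pos-+ (f zero) _) (cong (_+_ (+ f zero)) (+-Σℕ (f ∘ suc)))

  lookup-Σᵥ : ∀ {m} (f : Fin m → Vec ℤ n) j → lookup (Σᵥ f) j ≡ sum (λ k → lookup (f k) j)
  lookup-Σᵥ {zero}  f j = lookup-replicate j (+ 0)
  lookup-Σᵥ {suc m} f j =
    trans (lookup-zipWith _+_ j (f zero) _) (cong (_+_ (lookup (f zero) j)) (lookup-Σᵥ (f ∘ suc) j))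

  Σᵥ-cong : ∀ {m} {f g : Fin m → Vec ℤ n} → (∀ k → f k ≡ g k) → Σᵥ f ≡ Σᵥ g
  Σᵥ-cong {zero}  f≗g = refl
  Σᵥ-cong {suc m} f≗g = cong₂ (zipWith _+_) (f≗g zero) (Σᵥ-cong (f≗g ∘ suc))

  lookup-· : ∀ c (v : Vec ℤ n) j → lookup (c · v) j ≡ + c * lookup v j
  lookup-· c v j = lookup-map j (λ x → + c * x) v

  +-∸ : ∀ {m k} → k ≤ m → + (m ∸ k) ≡ + m - + k
  +-∸ {m} {k} k≤m = trans (sym (ℤ.⊖-≥ k≤m)) (sym (ℤ.m-n≡m⊖n m k))

  lookup-comb : ∀ u j → lookup (comb u) j ≡ sum (λ i → + lookup u i * lookup (A i) j)
  lookup-comb u j =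
    trans (lookup-Σᵥ (λ i → lookup u i · A i) j) (sum-cong-≗ (λ i → lookup-· (lookup u i) (A i) j))

  comb-updateAt-∸ : ∀ c i {k} → k ≤ lookup c i → comb (updateAt c i (_∸ k)) ≡ comb c -ᵥ (k · A i)
  comb-updateAt-∸ c i {k} k≤cᵢ = Pointwise-≡⇒≡ (ext λ j → begin
    lookup (comb c′) j                        ≡⟨ lookup-comb c′ j ⟩
    sum (G j)                                 ≡⟨ add-sub (sum (G j)) (F j i) ⟩
    sum (G j) + F j i - F j i
      ≡⟨ cong (_- F j i) (sum-exchange ℤ.+-0-commutativeMonoid i (agree j)) ⟩
    sum (F j) + G j i - F j i                 ≡⟨ cong (λ g → sum (F j) + g - F j i) (Gᵢ j) ⟩
    sum (F j) + (F j i - D j) - F j i         ≡⟨ cancel (sum (F j)) (F j i) (D j) ⟩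
    sum (F j) - D j                           ≡⟨ cong₂ _-_ (lookup-comb c j) (lookup-· k (A i) j) ⟨
    lookup (comb c) j - lookup (k · A i) j    ≡⟨ lookup-zipWith _-_ j (comb c) (k · A i) ⟨
    lookup (comb c -ᵥ (k · A i)) j            ∎)
    where
    open ≡-Reasoning
    c′ = updateAt c i (_∸ k)
    G F : Fin n → Fin N → ℤ
    G j l = + lookup c′ l * lookup (A l) j
    F j l = + lookup c l * lookup (A l) j
    D : Fin n → ℤ
    D j = + k * lookup (A i) j
    agree : ∀ j l → l ≢ i → G j l ≡ F j l
    agree j l l≢i = cong (λ x → + x * lookup (A l) j) (lookup∘updateAt′ l i l≢i c)
    distrib : ∀ x y z → (x - y) * z ≡ x * z - y * z
    distrib = solve-∀
    Gᵢ : ∀ j → G j i ≡ F j i - D j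
    Gᵢ j = trans (cong (λ x → + x * lookup (A i) j) (lookup∘updateAt i c))
                 (trans (cong (_* lookup (A i) j) (+-∸ k≤cᵢ)) (distrib (+ lookup c i) (+ k) (lookup (A i) j)))
    add-sub : ∀ x y → x ≡ x + y - y
    add-sub = solve-∀
    cancel : ∀ s x d → s + (x - d) - x ≡ s - d
    cancel = solve-∀

  comb-tabulate-Σ : ∀ {m} (w : Fin m → ℕ) (us : Fin m → Vec ℕ N) →
                    comb (tabulate (λ i → Σℕ (λ k → lookup (us k) i ℕ.* w k))) ≡ Σᵥ (λ k → w k · comb (us k))
  comb-tabulate-Σ w us = Pointwise-≡⇒≡ (ext λ j → begin
    lookup (comb u) j                         ≡⟨ lookup-comb u j ⟩
    sum (λ i → + lookup u i * a i j)          ≡⟨ sum-cong-≗ (expand-coordinate j) ⟩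
    sum (λ i → sum (λ k → + x k i * a i j))   ≡⟨ ∑-comm (λ i k → + x k i * a i j) ⟩
    sum (λ k → sum (λ i → + x k i * a i j))   ≡⟨ sum-cong-≗ (factor-weight j) ⟨
    sum (λ k → lookup (w k · comb (us k)) j)  ≡⟨ lookup-Σᵥ (λ k → w k · comb (us k)) j ⟨
    lookup (Σᵥ (λ k → w k · comb (us k))) j   ∎)
    where
    open ≡-Reasoning
    x : Fin _ → Fin N → ℕ
    x k i = lookup (us k) i ℕ.* w k
    u = tabulate (λ i → Σℕ (λ k → x k i))
    a : Fin N → Fin n → ℤ
    a i j = lookup (A i) j

    expand-coordinate : ∀ j i → + lookup u i * a i j ≡ sum (λ k → + x k i * a i j)
    expand-coordinate j i = begin
      + lookup u i * a i j         ≡⟨ cong (λ y → + y * a i j) (lookup∘tabulate (λ i → Σℕ (λ k → x k i)) i) ⟩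
      + Σℕ (λ k → x k i) * a i j   ≡⟨ cong (_* a i j) (+-Σℕ (λ k → x k i)) ⟩
      sum (λ k → + x k i) * a i j  ≡⟨ *-distribʳ-sum (a i j) (λ k → + x k i) ⟩
      sum (λ k → + x k i * a i j)  ∎

    commute : ∀ y z b → z * (y * b) ≡ y * z * b
    commute = solve-∀

    factor-weight : ∀ j k → lookup (w k · comb (us k)) j ≡ sum (λ i → + x k i * a i j)
    factor-weight j k = begin
      lookup (w k · comb (us k)) j               ≡⟨ lookup-· (w k) (comb (us k)) j ⟩
      + w k * lookup (comb (us k)) j             ≡⟨ cong (_*_ (+ w k)) (lookup-comb (us k) j) ⟩
      + w k * sum (λ i → + uₖ i * a i j)         ≡⟨ *-distribˡ-sum (+ w k) (λ i → + uₖ i * a i j) ⟩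
      sum (λ i → + w k * (+ uₖ i * a i j))       ≡⟨ sum-cong-≗ (λ i → commute (+ uₖ i) (+ w k) (a i j)) ⟩
      sum (λ i → + uₖ i * + w k * a i j)         ≡⟨ sum-cong-≗ (λ i → cong (_* a i j) (ℤ.pos-* (uₖ i) (w k))) ⟨
      sum (λ i → + x k i * a i j)                ∎
      where
      uₖ = lookup (us k)

module Proposition (p : ℕ) {{p≢0 : NonZero p}} (1<p : 1 < p) (a : ℕ) (1≤a : 1 ≤ a)
                   {n N : ℕ} (A : Fin N → Vec ℤ n) (M : Vec ℤ n → Set) where
  open import Data.Nat using (_+_; _*_)
  open import Data.Nat.Properties
  open import Data.Nat.Induction using (<-wellFounded)
  open import Data.Fin.Properties using (any?)
  open import Data.Vec using (tabulate; updateAt)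
  open import Data.Vec.Properties using (lookup∘tabulate)
  open import Data.Vec.Functional.Properties using (updateAt-updates; updateAt-minimal)
  open import Induction.WellFounded using (Acc; acc)
  open import Relation.Nullary using (yes; no)
  open Setup A
  open Setup.WithPrime A p a M
  open Digits p 1<p
  open LinearCombination A

  P : ∀ {m} → Fin m → ℕ
  P k = p ^ toℕ k

  instance
    q≢0 : NonZero q
    q≢0 = m^n≢0 p a

  ≤q∸1⇒<q : ∀ {x} → x ≤ q ∸ 1 → x < q
  ≤q∸1⇒<q = m≤pred[n]⇒suc[m]≤n

  1<q : 1 < q
  1<q = ^-monoʳ-< p 1<p 1≤a

  Σweight : Vec ℕ N → ℕ
  Σweight c = Σℕ (λ i → weight a (lookup c i))

  wp≡Σweight : ∀ u → Uq u → wp u ≡ Σweight u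
  wp≡Σweight u u≤q∸1 = Σℕ-cong λ i → sym (trans (weight-< a (lookup u i) (≤q∸1⇒<q (u≤q∸1 i)))
                                                (Σℕ-cong (digits≡digit a (lookup u i))))

  lower : Vec ℕ N → Fin N → Vec ℕ N
  lower c i = updateAt c i (_∸ (q ∸ 1))

  module _ (c : Vec ℕ N) (i : Fin N) (q≤cᵢ : q ≤ lookup c i) where
    private
      q∸1≤cᵢ : q ∸ 1 ≤ lookup c i
      q∸1≤cᵢ = ≤-trans (m∸n≤m q 1) q≤cᵢ

    size-lower : size (lower c i) < size c
    size-lower = Σℕ-updateAt-< id c i _ (∸-monoʳ-< (m<n⇒0<n∸m 1<q) q∸1≤cᵢ)

    Σweight-lower : Σweight (lower c i) ≤ Σweight c
    Σweight-lower = Σℕ-updateAt-≤ (weight a) c i _ (weight-∸ a (lookup c i) q≤cᵢ)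

    comb-lower : comb (lower c i) ≡ comb c -ᵥ ((q ∸ 1) · A i)
    comb-lower = comb-updateAt-∸ c i q∸1≤cᵢ

  LoweringClosed : Set
  LoweringClosed = ∀ x → M x → ∀ (c : Vec ℕ N) → comb c ≡ x → ∀ i₀ → q ≤ lookup c i₀ → M (x -ᵥ ((q ∸ 1) · A i₀))

  module _ (closed : LoweringClosed) where
    reduce : ∀ c → Acc _<_ (size c) → M (comb c) → ∃ λ u → UM u × wp u ≤ Σweight c
    reduce c (acc smaller) Mc with any? (λ i → q ≤? lookup c i)
    ... | no ¬q≤c = c , (c≤q∸1 , Mc) , ≤-reflexive (wp≡Σweight c c≤q∸1)
      where
      c≤q∸1 : Uq c
      c≤q∸1 i = <⇒≤pred (≰⇒> (λ q≤cᵢ → ¬q≤c (i , q≤cᵢ)))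
    ... | yes (i , q≤cᵢ) =
      let u , UMu , wp≤ = reduce (lower c i) (smaller (size-lower c i q≤cᵢ)) M-lower
      in  u , UMu , ≤-trans wp≤ (Σweight-lower c i q≤cᵢ)
      where
      M-lower : M (comb (lower c i))
      M-lower = subst M (sym (comb-lower c i q≤cᵢ)) (closed (comb c) Mc c refl i q≤cᵢ)

    reduce-to-UM : ∀ c → M (comb c) → ∃ λ u → UM u × wp u ≤ Σweight c
    reduce-to-UM c = reduce c (<-wellFounded (size c))

  digitVector : Vec ℕ N → Fin a → Vec ℕ N
  digitVector u k = tabulate (λ i → digit (lookup u i) (toℕ k))

  lookup-digitVector : ∀ u k i → lookup (digitVector u k) i ≡ digits a (lookup u i) k
  lookup-digitVector u k i = trans (lookup∘tabulate _ i) (sym (digits≡digit a (lookup u i) k))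

  wp≡Σsize-digitVector : ∀ u → wp u ≡ Σℕ (λ k → size (digitVector u k))
  wp≡Σsize-digitVector u = trans (Σℕ-comm {N} {a} digitᵢₖ)
                                 (Σℕ-cong {a} λ k → Σℕ-cong {N} λ i → sym (lookup∘tabulate (λ i → digitᵢₖ i k) i))
    where
    digitᵢₖ : Fin N → Fin a → ℕ
    digitᵢₖ i k = digit (lookup u i) (toℕ k)

  Expansion : (Fin a → Vec ℕ N) → Vec ℕ N → Set
  Expansion us u = ∀ i → lookup u i ≡ Σℕ (λ k → lookup (us k) i * P k)

  digitVector-expansion : ∀ u → Uq u → Expansion (digitVector u) u
  digitVector-expansion u u≤q∸1 i = sym (begin
    Σℕ (λ k → lookup (digitVector u k) i * P k)  ≡⟨ Σℕ-cong (λ k → cong (_* P k) (lookup-digitVector u k i)) ⟩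
    Σℕ (λ k → digits a (lookup u i) k * P k)     ≡⟨ Σ-digits a (lookup u i) (≤q∸1⇒<q (u≤q∸1 i)) ⟩
    lookup u i                                   ∎)
    where open ≡-Reasoning

  expansion-unique : ∀ us u → (∀ k i → lookup (us k) i < p) → Expansion us u →
                     (∀ k → us k ≡ digitVector u k) × Uq u
  expansion-unique us u us<p exp =
    (λ k → Pointwise-≡⇒≡ (ext λ i → sym (trans (lookup-digitVector u k i) (proj₁ (unique i) k)))) ,
    (λ i → <⇒≤pred (proj₂ (unique i)))
    where
    unique : ∀ i → (∀ k → digits a (lookup u i) k ≡ lookup (us k) i) × lookup u i < q
    unique i rewrite exp i = digits-Σ a (λ k → lookup (us k) i) (λ k → us<p k i)

  comb-expansion : ∀ us u → Expansion us u → comb u ≡ Σᵥ (λ k → P k · comb (us k))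
  comb-expansion us u exp =
    trans (cong comb u≡tabulate) (comb-tabulate-Σ P us)
    where
    expanded : Fin N → ℕ
    expanded i = Σℕ (λ k → lookup (us k) i * P k)
    u≡tabulate : u ≡ tabulate expanded
    u≡tabulate = Pointwise-≡⇒≡ (ext λ i → trans (exp i) (sym (lookup∘tabulate expanded i)))

  Σweight-expansion-≤ : ∀ us c → Expansion us c → Σweight c ≤ Σℕ (λ k → size (us k))
  Σweight-expansion-≤ us c exp = begin
    Σweight c                                              ≡⟨ Σℕ-cong (λ i → cong (weight a) (exp i)) ⟩
    Σℕ (λ i → weight a (Σℕ (λ k → lookup (us k) i * P k)))
      ≤⟨ Σℕ-mono-≤ (λ i → weight-Σ-≤ a (λ k → lookup (us k) i)) ⟩
    Σℕ (λ i → Σℕ (λ k → lookup (us k) i))                  ≡⟨ Σℕ-comm (λ i k → lookup (us k) i) ⟩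
    Σℕ (λ k → size (us k))                                 ∎
    where open ≤-Reasoning

  Σweight-expansion-< : ∀ us c → Expansion us c → ∀ k i → p ≤ lookup (us k) i →
                        Σweight c < Σℕ (λ k → size (us k))
  Σweight-expansion-< us c exp k i p≤ = begin-strict
    Σweight c                                              ≡⟨ Σℕ-cong (λ i → cong (weight a) (exp i)) ⟩
    Σℕ (λ i → weight a (Σℕ (λ k → lookup (us k) i * P k)))
      <⟨ Σℕ-mono-< (λ i → weight-Σ-≤ a (λ k → lookup (us k) i)) i (weight-Σ-< a (λ k → lookup (us k) i) k p≤) ⟩
    Σℕ (λ i → Σℕ (λ k → lookup (us k) i))                  ≡⟨ Σℕ-comm (λ i k → lookup (us k) i) ⟩
    Σℕ (λ k → size (us k))                                 ∎
    where open ≤-Reasoning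

  module _ (closed : LoweringClosed) (u : Vec ℕ N) (u-min : UMmin u)
           (k : Fin a) (v : Vec ℕ N) (comb-v : comb v ≡ comb (digitVector u k)) where
    private
      us = digitVector u
      vs = Vector.updateAt us k (λ _ → v)

      c : Vec ℕ N
      c = tabulate (λ i → Σℕ (λ k′ → lookup (vs k′) i * P k′))

      c-expansion : Expansion vs c
      c-expansion i = lookup∘tabulate (λ i → Σℕ (λ k′ → lookup (vs k′) i * P k′)) i

      comb-vs : ∀ k′ → comb (vs k′) ≡ comb (us k′)
      comb-vs k′ with k′ Data.Fin.≟ k
      ... | yes refl = trans (cong comb (updateAt-updates k us)) comb-v
      ... | no k′≢k  = cong comb (updateAt-minimal k′ k us k′≢k)

      comb-c : comb c ≡ comb u
      comb-c = begin
        comb c                             ≡⟨ comb-expansion vs c c-expansion ⟩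
        Σᵥ (λ k′ → P k′ · comb (vs k′))    ≡⟨ Σᵥ-cong (λ k′ → cong (P k′ ·_) (comb-vs k′)) ⟩
        Σᵥ (λ k′ → P k′ · comb (us k′))    ≡⟨ comb-expansion us u (digitVector-expansion u (proj₁ (proj₁ u-min))) ⟨
        comb u                             ∎
        where open ≡-Reasoning

      wp≤Σweight : wp u ≤ Σweight c
      wp≤Σweight =
        let u′ , UMu′ , wp≤ = reduce-to-UM closed c (subst M (sym comb-c) (proj₂ (proj₁ u-min)))
        in  ≤-trans (proj₂ u-min u′ UMu′) wp≤

      sizes : Σℕ (λ k′ → size (vs k′)) + size (us k) ≡ wp u + size v
      sizes = trans (Σℕ-exchange k (λ k′ k′≢k → cong size (updateAt-minimal k′ k us k′≢k)))
                    (cong₂ _+_ (sym (wp≡Σsize-digitVector u)) (cong size (updateAt-updates k us)))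

    digitVector-size-≤ : size (us k) ≤ size v
    digitVector-size-≤ = +-cancelˡ-≤ (wp u) _ _ (begin
      wp u + size (us k)
        ≤⟨ +-monoˡ-≤ _ (≤-trans wp≤Σweight (Σweight-expansion-≤ vs c c-expansion)) ⟩
      Σℕ (λ k′ → size (vs k′)) + size (us k)     ≡⟨ sizes ⟩
      wp u + size v                              ∎)
      where open ≤-Reasoning

    digitVector-size-< : ∀ i → p ≤ lookup v i → size (us k) < size v
    digitVector-size-< i p≤vᵢ = +-cancelˡ-< (wp u) _ _ (begin-strict
      wp u + size (us k)
        <⟨ +-monoˡ-< _ (≤-<-trans wp≤Σweight (Σweight-expansion-< vs c c-expansion k i p≤vsₖᵢ)) ⟩
      Σℕ (λ k′ → size (vs k′)) + size (us k)     ≡⟨ sizes ⟩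
      wp u + size v                              ∎)
      where
      open ≤-Reasoning
      p≤vsₖᵢ : p ≤ lookup (vs k) i
      p≤vsₖᵢ = subst (λ w → p ≤ lookup w i) (sym (updateAt-updates k us)) p≤vᵢ

  UMmin⇒ΓM : LoweringClosed → ∀ u → UMmin u → ∃ λ γ → ΓM γ × Uγ γ u
  UMmin⇒ΓM closed u u-min = γ , (good , M-expand , (λ k → size (us k)) , w-us , wp-M) , us , us-min , expansion
    where
    us = digitVector u
    γ = tabulate (λ k → comb (us k))

    γₖ : ∀ k → lookup γ k ≡ comb (us k)
    γₖ = lookup∘tabulate (λ k → comb (us k))

    expansion : Expansion us u
    expansion = digitVector-expansion u (proj₁ (proj₁ u-min))

    us-min : ∀ k → U⁺min (lookup γ k) (us k)
    us-min k = sym (γₖ k) , λ v U⁺v → digitVector-size-≤ closed u u-min k v (trans U⁺v (γₖ k))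

    good : ∀ k → Good p (lookup γ k)
    good k = (us k , sym (γₖ k)) , λ v (U⁺v , v-min) i → <⇒≤pred (≰⇒> λ p≤vᵢ →
      <⇒≱ (digitVector-size-< closed u u-min k v (trans U⁺v (γₖ k)) i p≤vᵢ) (v-min (us k) (sym (γₖ k))))

    M-expand : M (expand γ)
    M-expand = subst M (trans (comb-expansion us u expansion) (Σᵥ-cong (λ k → cong (P k ·_) (sym (γₖ k)))))
                       (proj₂ (proj₁ u-min))

    w-us : ∀ k → IsW (lookup γ k) (size (us k))
    w-us k = (us k , sym (γₖ k) , refl) , proj₂ (us-min k)

    wp-M : IsWpM (Σℕ (λ k → size (us k)))
    wp-M = (u , proj₁ u-min , wp≡Σsize-digitVector u) ,
           λ v UMv → subst (_≤ wp v) (wp≡Σsize-digitVector u) (proj₂ u-min v UMv)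

  Uγ-digitVector : ∀ γ u → ΓM γ → (U : Uγ γ u) → (∀ k → proj₁ U k ≡ digitVector u k) × Uq u
  Uγ-digitVector γ u (good , _) (us , us-min , expansion) =
    expansion-unique us u (λ k i → m≤pred[n]⇒suc[m]≤n (proj₂ (good k) (us k) (us-min k) i)) expansion

  U⁺min-size≡w : ∀ γ u w → U⁺min γ u → IsW γ w → size u ≡ w
  U⁺min-size≡w γ u w (U⁺u , u-min) ((v , U⁺v , size-v) , w-min) =
    ≤-antisym (≤-trans (u-min v U⁺v) (≤-reflexive size-v)) (w-min u U⁺u)

  ΓM⇒UMmin : ∀ u → (∃ λ γ → ΓM γ × Uγ γ u) → UMmin u
  ΓM⇒UMmin u (γ , Γ@(_ , M-expand , ws , w-ws , wp-M) , U@(us , us-min , expansion)) =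
    (proj₂ digits-u , M-u) , λ v UMv → subst (_≤ wp v) (sym wp≡Σws) (proj₂ wp-M v UMv)
    where
    digits-u = Uγ-digitVector γ u Γ U

    M-u : M (comb u)
    M-u = subst M (sym (trans (comb-expansion us u expansion) (Σᵥ-cong (λ k → cong (P k ·_) (proj₁ (us-min k))))))
                  M-expand

    wp≡Σws : wp u ≡ Σℕ ws
    wp≡Σws = begin
      wp u                                   ≡⟨ wp≡Σsize-digitVector u ⟩
      Σℕ (λ k → size (digitVector u k))      ≡⟨ Σℕ-cong (λ k → cong size (proj₁ digits-u k)) ⟨
      Σℕ (λ k → size (us k))
        ≡⟨ Σℕ-cong (λ k → U⁺min-size≡w (lookup γ k) (us k) (ws k) (us-min k) (w-ws k)) ⟩
      Σℕ ws                                  ∎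
      where open ≡-Reasoning

  ΓM-disjoint : ∀ γ γ′ → ΓM γ → ΓM γ′ → ∀ u → Uγ γ u → Uγ γ′ u → γ ≡ γ′
  ΓM-disjoint γ γ′ Γ Γ′ u U@(us , us-min , _) U′@(us′ , us′-min , _) = Pointwise-≡⇒≡ (ext λ k → begin
    lookup γ k     ≡⟨ proj₁ (us-min k) ⟨
    comb (us k)    ≡⟨ cong comb (trans (proj₁ (Uγ-digitVector γ u Γ U) k)
                                        (sym (proj₁ (Uγ-digitVector γ′ u Γ′ U′) k))) ⟩
    comb (us′ k)   ≡⟨ proj₁ (us′-min k) ⟩
    lookup γ′ k    ∎)
    where open ≡-Reasoning

proposition5p14 :
    (p : ℕ) (pr : Prime p) (a : ℕ) → 1 ≤ a →
    (n N : ℕ) (A : Fin N → Vec ℤ n) (M : Vec ℤ n → Set) →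
    let open Setup A in
    let open Setup.WithPrime A p {{prime⇒nonZero pr}} a M in
    (∀ x → M x → ∀ (c : Vec ℕ N) → comb c ≡ x →
       ∀ i₀ → q ≤ lookup c i₀ → M (x -ᵥ ((q ∸ 1) · A i₀))) →
    (∃ λ u → UM u) →
    (∀ γ γ′ → ΓM γ → ΓM γ′ → ∀ u → Uγ γ u → Uγ γ′ u → γ ≡ γ′)
    × (∀ u → UMmin u ⇔ (∃ λ γ → ΓM γ × Uγ γ u))
proposition5p14 p pr a 1≤a n N A M closed _ =
  ΓM-disjoint , λ u → mk⇔ (UMmin⇒ΓM closed u) (ΓM⇒UMmin u)
  where
  open Proposition p {{prime⇒nonZero pr}} (nonTrivial⇒n>1 p {{prime⇒nonTrivial pr}}) a 1≤a A M
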